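{- Let $n\ge1$, $k\in\{1,\dots,n\}$, let $w$ be a chessboard element of $B_n$, and let $x$ be a sign, left, single-minus, double-minus, single-plus or double-plus swap for $w$ with respect to $k$. Then $x$ is again a swap for $\mathrm{swap}_x(w)$ with respect to $k$ (of the same type).
   Context: $B_n$ is the group of bijections $w$ of $\{ -n,\dots,n\}$ with $w(-i)=-w(i)$; $w$ is chessboard if $|w(j)|\equiv j\pmod2$ for all $j$. The signed permutation matrix of $w$ has $w_{i,j}=1$ if $w(j)=i$, $-1$ if $w(j)=-i$, $0$ otherwise. For a column $t$, $i(t)=|w(t)|$; for a row $s$, $j(s)$ is the column of its nonzero entry. Fix a column $k$. A sign swap is $(t)$ with $t\in[n]$, $t$ even, $t\le k$, and $j(s)>k$ for every row $s<i(t)$; $\mathrm{swap}_{(t)}(w)$ changes the sign of the entry in column $t$. A two swap is $(b,t)$ with $1\le b<t\le n$, $b\equiv t\pmod2$, and $j(s)>k$ for every row $s$ strictly between $i(b)$ and $i(t)$; $\mathrm{swap}_{(b,t)}(w)$ interchanges rows $i(b)$ and $i(t)$ (entries keep their signs). A two swap $(b,t)$ is: a left swap if $t\le k$; a double-minus swap if $w_{i(b),b}=w_{i(t),t}=-1$, $k<b<t$, and $w_{s,j(s)}=1$ for all rows $s$ strictly between $i(b),i(t)$; a single-minus swap if $w_{i(t),t}=-1$, $b\le k<t$, and $w_{s,j(s)}=1$ for all rows strictly between; a double-plus swap if $w_{i(b),b}=w_{i(t),t}=1$, $k<b<t$, and $w_{s,j(s)}=-1$ for all rows strictly between; a single-plus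 swap if $w_{i(t),t}=1$, $b\le k<t$, and $w_{s,j(s)}=-1$ for all rows strictly between. -}

module Defs where

open import Data.Nat using (ℕ; zero; suc; _≤_; _<_; _%_)
open import Data.Sum using (_⊎_)
open import Data.Empty using (⊥)
open import Relation.Nullary using (yes; no)
import Data.Fin as F
open import Data.Fin using (Fin; toℕ)
open import Data.Fin.Permutation using (Permutation′; _⟨$⟩ʳ_; _⟨$⟩ˡ_; _∘ₚ_; transpose)
open import Data.Integer using (ℤ; +_; -_)
open import Data.Bool using (Bool; true; false; not; if_then_else_)
open import Data.Product using (_×_)
open import Relation.Binary.PropositionalEquality using (_≡_)

-- Columns and rows are elements of Fin n; the element
-- q : Fin n stands for the integer  pos q = toℕ q + 1  ∈ {1,…,n}.
-- A signed permutation w is determined by its values on {1,…,n}: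
-- w(j) = sign(j) · |w(j)|, with j ↦ |w(j)| a permutation of {1,…,n}
-- (then w(-j) = -w(j) and w(0) = 0 determine the rest).
record SignedPerm (n : ℕ) : Set where
  constructor mkSP
  field
    perm : Permutation′ n     -- column t ↦ row i(t) = |w(t)|
    sign : Fin n → Bool       -- true : w(t) = +|w(t)|,  false : w(t) = -|w(t)|

open SignedPerm public

pos : {n : ℕ} → Fin n → ℕ
pos q = suc (toℕ q)

iRow : {n : ℕ} → SignedPerm n → Fin n → Fin n
iRow w t = perm w ⟨$⟩ʳ t

jCol : {n : ℕ} → SignedPerm n → Fin n → Fin n
jCol w s = perm w ⟨$⟩ˡ s

colEntry : {n : ℕ} → SignedPerm n → Fin n → ℤ
colEntry w t = if sign w t then + 1 else - (+ 1)

rowEntry : {n : ℕ} → SignedPerm n → Fin n → ℤ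
rowEntry w s = colEntry w (jCol w s)

-- w is chessboard: |w(j)| ≡ j (mod 2) for all j ∈ [n]
-- (for negative j this follows by symmetry, for j = 0 trivially)
Chessboard : {n : ℕ} → SignedPerm n → Set
Chessboard {n} w = (j : Fin n) → pos (iRow w j) % 2 ≡ pos j % 2

StrictlyBetween : {n : ℕ} → Fin n → Fin n → Fin n → Set
StrictlyBetween a c s =
  (toℕ a < toℕ s × toℕ s < toℕ c) ⊎ (toℕ c < toℕ s × toℕ s < toℕ a)

data Swap (n : ℕ) : Set where
  sgnSwap : Fin n → Swap n
  twoSwap : Fin n → Fin n → Swap n

data SwapType : Set where
  signSw left singleMinus doubleMinus singlePlus doublePlus : SwapType

IsSignSwap : {n : ℕ} → ℕ → SignedPerm n → Fin n → Set
IsSignSwap {n} k w t =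
  pos t % 2 ≡ 0 × pos t ≤ k ×
  ((s : Fin n) → toℕ s < toℕ (iRow w t) → k < pos (jCol w s))

IsTwoSwap : {n : ℕ} → ℕ → SignedPerm n → Fin n → Fin n → Set
IsTwoSwap {n} k w b t =
  toℕ b < toℕ t × pos b % 2 ≡ pos t % 2 ×
  ((s : Fin n) → StrictlyBetween (iRow w b) (iRow w t) s → k < pos (jCol w s))

BetweenEntries : {n : ℕ} → SignedPerm n → Fin n → Fin n → ℤ → Set
BetweenEntries {n} w b t e =
  (s : Fin n) → StrictlyBetween (iRow w b) (iRow w t) s → rowEntry w s ≡ e

IsSwapOfType : {n : ℕ} → ℕ → SignedPerm n → SwapType → Swap n → Set
IsSwapOfType k w signSw (sgnSwap t) = IsSignSwap k w t
IsSwapOfType k w signSw (twoSwap b t) = ⊥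
IsSwapOfType k w left (sgnSwap t) = ⊥
IsSwapOfType k w left (twoSwap b t) = IsTwoSwap k w b t × pos t ≤ k
IsSwapOfType k w singleMinus (sgnSwap t) = ⊥
IsSwapOfType k w singleMinus (twoSwap b t) =
  IsTwoSwap k w b t × colEntry w t ≡ - (+ 1) × pos b ≤ k × k < pos t ×
  BetweenEntries w b t (+ 1)
IsSwapOfType k w doubleMinus (sgnSwap t) = ⊥
IsSwapOfType k w doubleMinus (twoSwap b t) =
  IsTwoSwap k w b t × colEntry w b ≡ - (+ 1) × colEntry w t ≡ - (+ 1) ×
  k < pos b × BetweenEntries w b t (+ 1)
IsSwapOfType k w singlePlus (sgnSwap t) = ⊥
IsSwapOfType k w singlePlus (twoSwap b t) =
  IsTwoSwap k w b t × colEntry w t ≡ + 1 × pos b ≤ k × k < pos t ×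
  BetweenEntries w b t (- (+ 1))
IsSwapOfType k w doublePlus (sgnSwap t) = ⊥
IsSwapOfType k w doublePlus (twoSwap b t) =
  IsTwoSwap k w b t × colEntry w b ≡ + 1 × colEntry w t ≡ + 1 ×
  k < pos b × BetweenEntries w b t (- (+ 1))

flipAt : {n : ℕ} → (Fin n → Bool) → Fin n → Fin n → Bool
flipAt f t c with c F.≟ t
... | yes _ = not (f c)
... | no _ = f c

applySwap : {n : ℕ} → Swap n → SignedPerm n → SignedPerm n
applySwap (sgnSwap t) w = mkSP (perm w) (flipAt (sign w) t)
-- interchange rows i(b), i(t): new |w|(c) = τ(i(c)) with τ = (i(b) i(t));
-- signs stay attached to their columns
applySwap (twoSwap b t) w =
  mkSP (perm w ∘ₚ transpose (iRow w b) (iRow w t)) (sign w)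

-- A sign swap leaves the underlying permutation w ↦ |w| unchanged, and every
-- condition defining a sign swap reads only that permutation.  A two swap (b,t)
-- keeps the sign of every column and exchanges the rows i(b) and i(t): the
-- interval of rows strictly between them is the same set, and each of its rows
-- keeps its column and hence its entry.  So all defining conditions of each type
-- of two swap are preserved.
module Submission where

open import Defs
open import Data.Nat using (ℕ; _≤_; _<_)
open import Data.Fin using (Fin; _≟_)
open import Data.Fin.Properties using (<⇒≢)
import Data.Fin.Permutation.Components as PC
open import Data.Sum using (inj₁; inj₂)
open import Data.Product using (_,_)
open import Function using (_∘′_)
open import Relation.Nullary using (yes; no)
open import Relation.Nullary.Decidable using (dec-true; dec-false)
open import Relation.Binary.PropositionalEquality

transpose-matchˡ : ∀ {n} (i j : Fin n) → PC.transpose i j i ≡ j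
transpose-matchˡ i j rewrite dec-true (i ≟ i) refl = refl

transpose-matchʳ : ∀ {n} (i j : Fin n) → PC.transpose i j j ≡ i
transpose-matchʳ i j with j ≟ i
... | yes j≡i = j≡i
... | no _ rewrite dec-true (j ≟ j) refl = refl

transpose-fixes : ∀ {n} {i j k : Fin n} → k ≢ i → k ≢ j → PC.transpose i j k ≡ k
transpose-fixes {i = i} {j} {k} k≢i k≢j
  rewrite dec-false (k ≟ i) k≢i | dec-false (k ≟ j) k≢j = refl

StrictlyBetween-sym : ∀ {n} {a c s : Fin n} →
  StrictlyBetween a c s → StrictlyBetween c a s
StrictlyBetween-sym (inj₁ a<s<c) = inj₂ a<s<c
StrictlyBetween-sym (inj₂ c<s<a) = inj₁ c<s<a

StrictlyBetween⇒≢ˡ : ∀ {n} {a c s : Fin n} → StrictlyBetween a c s → s ≢ a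
StrictlyBetween⇒≢ˡ (inj₁ (a<s , _)) = ≢-sym (<⇒≢ a<s)
StrictlyBetween⇒≢ˡ (inj₂ (_ , s<a)) = <⇒≢ s<a

StrictlyBetween⇒≢ʳ : ∀ {n} {a c s : Fin n} → StrictlyBetween a c s → s ≢ c
StrictlyBetween⇒≢ʳ = StrictlyBetween⇒≢ˡ ∘′ StrictlyBetween-sym

module _ {n : ℕ} (w : SignedPerm n) (b t : Fin n) where

  private
    w′ : SignedPerm n
    w′ = applySwap (twoSwap b t) w

  StrictlyBetween-twoSwap : ∀ {s} →
    StrictlyBetween (iRow w′ b) (iRow w′ t) s →
    StrictlyBetween (iRow w b) (iRow w t) s
  StrictlyBetween-twoSwap
    rewrite transpose-matchˡ (iRow w b) (iRow w t)
          | transpose-matchʳ (iRow w b) (iRow w t) = StrictlyBetween-sym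

  jCol-twoSwap : ∀ {s} → StrictlyBetween (iRow w b) (iRow w t) s →
    jCol w′ s ≡ jCol w s
  jCol-twoSwap between =
    cong (jCol w) (transpose-fixes (StrictlyBetween⇒≢ʳ between)
                                   (StrictlyBetween⇒≢ˡ between))

  IsTwoSwap-twoSwap : ∀ {k} → IsTwoSwap k w b t → IsTwoSwap k w′ b t
  IsTwoSwap-twoSwap {k} (b<t , parity , rightOfK) = b<t , parity , λ s between′ →
    let between = StrictlyBetween-twoSwap between′
    in subst (λ c → k < pos c) (sym (jCol-twoSwap between)) (rightOfK s between)

  BetweenEntries-twoSwap : ∀ {e} → BetweenEntries w b t e → BetweenEntries w′ b t e
  BetweenEntries-twoSwap entries s between′ =
    let between = StrictlyBetween-twoSwap between′
    in trans (cong (colEntry w) (jCol-twoSwap between)) (entries s between)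

lemma5p17 : (n k : ℕ) → 1 ≤ n → 1 ≤ k → k ≤ n →
    (w : SignedPerm n) → Chessboard w →
    (ty : SwapType) (x : Swap n) →
    IsSwapOfType k w ty x →
    IsSwapOfType k (applySwap x w) ty x
lemma5p17 n k _ _ _ w _ signSw (sgnSwap t) signSwap = signSwap
lemma5p17 n k _ _ _ w _ left (twoSwap b t) (two , t≤k) =
  IsTwoSwap-twoSwap w b t two , t≤k
lemma5p17 n k _ _ _ w _ singleMinus (twoSwap b t) (two , signᵗ , b≤k , k<t , entries) =
  IsTwoSwap-twoSwap w b t two , signᵗ , b≤k , k<t , BetweenEntries-twoSwap w b t entries
lemma5p17 n k _ _ _ w _ doubleMinus (twoSwap b t) (two , signᵇ , signᵗ , k<b , entries) =
  IsTwoSwap-twoSwap w b t two , signᵇ , signᵗ , k<b , BetweenEntries-twoSwap w b t entries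
lemma5p17 n k _ _ _ w _ singlePlus (twoSwap b t) (two , signᵗ , b≤k , k<t , entries) =
  IsTwoSwap-twoSwap w b t two , signᵗ , b≤k , k<t , BetweenEntries-twoSwap w b t entries
lemma5p17 n k _ _ _ w _ doublePlus (twoSwap b t) (two , signᵇ , signᵗ , k<b , entries) =
  IsTwoSwap-twoSwap w b t two , signᵇ , signᵗ , k<b , BetweenEntries-twoSwap w b t entries
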